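{- Let $c\in\mathbb{N}$ and let $\beta$ be a parameter. The map $(x_0,x_1,x_2,x_3)\mapsto(x_1,x_2,x_3,(x_1x_3+\beta x_2^c)/x_0)$ preserves the two-form \[\omega=\left(\frac{dx_0\wedge dx_1}{x_0x_1}+\frac{dx_0\wedge dx_3}{x_0x_3}+\frac{dx_2\wedge dx_3}{x_2x_3}\right)-c\left(\frac{dx_0\wedge dx_2}{x_0x_2}+\frac{dx_1\wedge dx_3}{x_1x_3}\right)+(c+1)\frac{dx_1\wedge dx_2}{x_1x_2},\] and $\omega$ is symplectic for $c\neq2$. When $c=2$ this two-form is degenerate, being the pullback of the two-form $\omega_1=(u_1u_2)^{ -1}\,du_1\wedge du_2$ under the transformation $(x_0,x_1,x_2,x_3)\mapsto(u_1,u_2)=\big(x_0x_2/x_1^2,\;x_1x_3/x_2^2\big)$. -}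

module Defs where

open import Level using (Level; suc; _⊔_)
open import Data.Nat as ℕ using (ℕ; zero)
open import Data.Fin using (Fin; _≟_; #_)
import Data.Fin as Fin
open import Data.Bool using (if_then_else_)
open import Relation.Nullary using (¬_; does)
open import Data.Product using (∃; _×_)
open import Algebra.Bundles using (CommutativeRing)

module Embed {a ℓ : Level} (R : CommutativeRing a ℓ) where
  open CommutativeRing R
  ι : ℕ → Carrier
  ι zero = 0#
  ι (ℕ.suc n) = 1# + ι n

-- A differential field of characteristic 0 with four derivations ∂₀,…,∂₃
-- (the abstract setting of rational functions in x₀,…,x₃ over a field
-- containing the parameter β, with ∂ₖ = ∂/∂xₖ).
record DiffField (a ℓ : Level) : Set (suc (a ⊔ ℓ)) where
  field
    commRing : CommutativeRing a ℓ
  open CommutativeRing commRing public hiding (ring)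
  open Embed commRing public
  field
    inv       : Carrier → Carrier
    inverseʳ  : ∀ z → z ≉ 0# → z * inv z ≈ 1#
    char0     : ∀ n → ι (ℕ.suc n) ≉ 0#
    ∂         : Fin 4 → Carrier → Carrier
    ∂-cong    : ∀ k {y z} → y ≈ z → ∂ k y ≈ ∂ k z
    ∂-+       : ∀ k y z → ∂ k (y + z) ≈ ∂ k y + ∂ k z
    ∂-*       : ∀ k y z → ∂ k (y * z) ≈ ∂ k y * z + y * ∂ k z

module Forms {a ℓ : Level} (K : DiffField a ℓ) where
  open DiffField K

  δ : ∀ {n} → Fin n → Fin n → Carrier
  δ k l = if does (k ≟ l) then 1# else 0#

  pow : Carrier → ℕ → Carrier
  pow y zero = 1#
  pow y (ℕ.suc n) = y * pow y n

  Σ : ∀ {n} → (Fin n → Carrier) → Carrier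
  Σ {zero} f = 0#
  Σ {ℕ.suc n} f = f Fin.zero + Σ (λ i → f (Fin.suc i))

  OneForm : Set a
  OneForm = Fin 4 → Carrier

  -- 2-forms: antisymmetric coefficient matrix, ω = Σ_{i<j} Ω i j dxᵢ∧dxⱼ
  TwoForm : Set a
  TwoForm = Fin 4 → Fin 4 → Carrier

  d : Carrier → OneForm
  d f k = ∂ k f

  _∧_ : OneForm → OneForm → TwoForm
  (α ∧ β) i j = α i * β j - α j * β i

  _⊕_ : TwoForm → TwoForm → TwoForm
  (ω ⊕ η) i j = ω i j + η i j

  _⊖_ : TwoForm → TwoForm → TwoForm
  (ω ⊖ η) i j = ω i j - η i j

  _·_ : Carrier → TwoForm → TwoForm
  (s · ω) i j = s * ω i j

  infixr 7 _·_
  infixl 6 _⊕_ _⊖_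

  _≈₂_ : TwoForm → TwoForm → Set ℓ
  ω ≈₂ η = ∀ i j → ω i j ≈ η i j

  Closed : TwoForm → Set ℓ
  Closed Ω = ∀ i j k → ∂ i (Ω j k) + ∂ j (Ω k i) + ∂ k (Ω i j) ≈ 0#

  Nondegenerate : TwoForm → Set (a ⊔ ℓ)
  Nondegenerate Ω = ∃ λ (N : Fin 4 → Fin 4 → Carrier) →
    ∀ i j → Σ (λ k → Ω i k * N k j) ≈ δ i j

  Symplectic : TwoForm → Set (a ⊔ ℓ)
  Symplectic Ω = Closed Ω × Nondegenerate Ω

  L : (Fin 4 → Carrier) → Fin 4 → Fin 4 → TwoForm
  L y p q = inv (y p * y q) · (d (y p) ∧ d (y q))

  -- ω expressed in coordinates y (ω = ωc c x; its pullback under a map φ is ωc c (φ x))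
  ωc : ℕ → (Fin 4 → Carrier) → TwoForm
  ωc c y = (L y (# 0) (# 1) ⊕ L y (# 0) (# 3) ⊕ L y (# 2) (# 3))
         ⊖ ι c · (L y (# 0) (# 2) ⊕ L y (# 1) (# 3))
         ⊕ ι (ℕ.suc c) · L y (# 1) (# 2)

  φ : ℕ → Carrier → (Fin 4 → Carrier) → (Fin 4 → Carrier)
  φ c β x Fin.zero = x (# 1)
  φ c β x (Fin.suc Fin.zero) = x (# 2)
  φ c β x (Fin.suc (Fin.suc Fin.zero)) = x (# 3)
  φ c β x (Fin.suc (Fin.suc (Fin.suc Fin.zero))) = (x (# 1) * x (# 3) + β * pow (x (# 2)) c) * inv (x (# 0))

  u₁ u₂ : (Fin 4 → Carrier) → Carrier
  u₁ x = (x (# 0) * x (# 2)) * inv (x (# 1) * x (# 1))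
  u₂ x = (x (# 1) * x (# 3)) * inv (x (# 2) * x (# 2))

  ω₁* : (Fin 4 → Carrier) → TwoForm
  ω₁* x = inv (u₁ x * u₂ x) · (d (u₁ x) ∧ d (u₂ x))

-- In the logarithmic differentials ξ_p = dx_p / x_p the form ω has constant
-- coefficients, ω = Σ_{p,q} A_pq ξ_p ⊗ ξ_q with A antisymmetric, and every ξ_p is
-- closed; hence ω is closed. The map φ sends (ξ₀, ξ₁, ξ₂, ξ₃) to
-- (ξ₁, ξ₂, ξ₃, s(ξ₁ + ξ₃) + (1 − s)c ξ₂ − ξ₀) with s = x₁x₃ / (x₁x₃ + βx₂ᶜ), and
-- invariance of ω becomes a polynomial identity in s, c and the ξ_p. At a point
-- the matrix of ω is D A D with D = diag(1/x_p); the Pfaffian of A is (2 − c)(1 + c),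
-- so for c ≠ 2 the matrix D⁻¹ adj(A) D⁻¹ / Pf(A) inverts it. For c = 2,
-- ω = d log u₁ ∧ d log u₂, and since u₁ and u₂ are homogeneous of degree 0 the
-- Euler vector (x₀, x₁, x₂, x₃) lies in the kernel of ω.

module Submission where

open import Defs
open import Level using (Level; 0ℓ)
open import Data.Nat using (ℕ)
open import Data.Fin using (Fin)
open import Data.Product using (_×_)
open import Relation.Binary.PropositionalEquality using (_≡_; _≢_)
open import Relation.Nullary using (¬_)

open import Algebra.Bundles using (CommutativeRing)
open import Algebra.Bundles.Raw using (RawRing)
import Algebra.Solver.Ring
open import Algebra.Solver.Ring.AlmostCommutativeRing
  using (fromCommutativeRing; _-Raw-AlmostCommutative⟶_)
open import Data.Fin using (zero; suc; _≟_)
open import Data.Fin.Patterns using (0F; 1F; 2F; 3F)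
open import Data.Integer as ℤ using (ℤ; +_; -[1+_]; _◃_; sign; ∣_∣)
import Data.Integer.Properties as ℤ
open import Data.Bool using (true; false; if_then_else_)
open import Data.Maybe using (Maybe; just; nothing)
open import Data.Nat as ℕ using (zero; suc)
import Data.Nat.Properties as ℕ
open import Data.Product using (_,_)
open import Data.Sign as Sign using (Sign)
import Data.Vec as Vec
open import Data.Vec.Functional using ([]; _∷_)
open import Function using (_∘_)
open import Relation.Binary.PropositionalEquality as ≡ using ()
open import Relation.Nullary using (yes; no; does; contradiction)

module IntegerCoefficients {a ℓ : Level} (R : CommutativeRing a ℓ) where
  open CommutativeRing R
  open import Algebra.Properties.Ring ring
    using (-0#≈0#; -‿involutive; -1*x≈-x; -‿+-comm; -‿distribʳ-*)
  open import Algebra.Properties.Semiring.Mult.TCOptimised semiring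
    using (×-homo-+; ×1-homo-*) renaming (_×_ to _×′_)
  open import Algebra.Properties.CommutativeSemigroup *-commutativeSemigroup
    using (interchange)
  open import Algebra.Properties.CommutativeSemigroup +-commutativeSemigroup
    using () renaming (interchange to +-interchange)
  open import Relation.Binary.Reasoning.Setoid setoid

  -- `_×′_` has 1 ×′ x = x, so the solver constants 0 and 1 evaluate to 0# and 1#
  -- on the nose, as needed when solver terms are compared with goals.
  fromℤ : ℤ → Carrier
  fromℤ (+ n)    = n ×′ 1#
  fromℤ -[1+ n ] = - (suc n ×′ 1#)

  fromℤ-⊖ : ∀ m n → fromℤ (m ℤ.⊖ n) ≈ m ×′ 1# - n ×′ 1#
  fromℤ-⊖ m       zero    = sym (trans (+-congˡ -0#≈0#) (+-identityʳ _))
  fromℤ-⊖ zero    (suc n) = sym (+-identityˡ _)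
  fromℤ-⊖ (suc m) (suc n) = begin
    fromℤ (suc m ℤ.⊖ suc n)           ≡⟨ ≡.cong fromℤ (ℤ.[1+m]⊖[1+n]≡m⊖n m n) ⟩
    fromℤ (m ℤ.⊖ n)                   ≈⟨ fromℤ-⊖ m n ⟩
    m ×′ 1# - n ×′ 1#                 ≈⟨ cancel 1# (m ×′ 1#) (n ×′ 1#) ⟨
    (1# + m ×′ 1#) - (1# + n ×′ 1#)   ≈⟨ +-cong (×-homo-+ 1# 1 m) (-‿cong (×-homo-+ 1# 1 n)) ⟨
    suc m ×′ 1# - suc n ×′ 1#         ∎
    where
    cancel : ∀ c x y → (c + x) - (c + y) ≈ x - y
    cancel c x y = begin
      (c + x) - (c + y)     ≈⟨ +-congˡ (-‿+-comm c y) ⟨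
      (c + x) + (- c - y)   ≈⟨ +-interchange c x (- c) (- y) ⟩
      (c - c) + (x - y)     ≈⟨ +-congʳ (-‿inverseʳ c) ⟩
      0# + (x - y)          ≈⟨ +-identityˡ _ ⟩
      x - y                 ∎

  fromℤ-+ : ∀ i j → fromℤ (i ℤ.+ j) ≈ fromℤ i + fromℤ j
  fromℤ-+ (+ m)    (+ n)    = ×-homo-+ 1# m n
  fromℤ-+ (+ m)    -[1+ n ] = fromℤ-⊖ m (suc n)
  fromℤ-+ -[1+ m ] (+ n)    = trans (fromℤ-⊖ n (suc m)) (+-comm _ _)
  fromℤ-+ -[1+ m ] -[1+ n ] = begin
    - (suc (suc m ℕ.+ n) ×′ 1#)    ≡⟨ ≡.cong (λ k → - (k ×′ 1#)) (≡.sym (ℕ.+-suc (suc m) n)) ⟩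
    - ((suc m ℕ.+ suc n) ×′ 1#)    ≈⟨ -‿cong (×-homo-+ 1# (suc m) (suc n)) ⟩
    - (suc m ×′ 1# + suc n ×′ 1#)   ≈⟨ -‿+-comm _ _ ⟨
    - (suc m ×′ 1#) - suc n ×′ 1#   ∎

  fromℤ-neg : ∀ i → fromℤ (ℤ.- i) ≈ - fromℤ i
  fromℤ-neg (+ zero)  = sym -0#≈0#
  fromℤ-neg (+ suc n) = refl
  fromℤ-neg -[1+ n ]  = sym (-‿involutive _)

  fromSign : Sign → Carrier
  fromSign Sign.+ = 1#
  fromSign Sign.- = - 1#

  fromSign-* : ∀ s t → fromSign (s Sign.* t) ≈ fromSign s * fromSign t
  fromSign-* Sign.+ t      = sym (*-identityˡ _)
  fromSign-* Sign.- Sign.+ = sym (*-identityʳ _)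
  fromSign-* Sign.- Sign.- = begin
    1#            ≈⟨ -‿involutive 1# ⟨
    - - 1#        ≈⟨ -‿cong (-1*x≈-x 1#) ⟨
    - (- 1# * 1#) ≈⟨ -‿distribʳ-* _ _ ⟩
    - 1# * - 1#   ∎

  fromℤ-◃ : ∀ s n → fromℤ (s ◃ n) ≈ fromSign s * (n ×′ 1#)
  fromℤ-◃ s      zero    = sym (zeroʳ _)
  fromℤ-◃ Sign.+ (suc n) = sym (*-identityˡ _)
  fromℤ-◃ Sign.- (suc n) = sym (-1*x≈-x _)

  fromℤ-signAbs : ∀ i → fromℤ i ≈ fromSign (sign i) * (∣ i ∣ ×′ 1#)
  fromℤ-signAbs (+ n)    = sym (*-identityˡ _)
  fromℤ-signAbs -[1+ n ] = sym (-1*x≈-x _)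

  fromℤ-* : ∀ i j → fromℤ (i ℤ.* j) ≈ fromℤ i * fromℤ j
  fromℤ-* i j = begin
    fromℤ ((sign i Sign.* sign j) ◃ (∣ i ∣ ℕ.* ∣ j ∣))
      ≈⟨ fromℤ-◃ (sign i Sign.* sign j) (∣ i ∣ ℕ.* ∣ j ∣) ⟩
    fromSign (sign i Sign.* sign j) * ((∣ i ∣ ℕ.* ∣ j ∣) ×′ 1#)
      ≈⟨ *-cong (fromSign-* (sign i) (sign j)) (×1-homo-* ∣ i ∣ ∣ j ∣) ⟩
    (fromSign (sign i) * fromSign (sign j)) * (∣ i ∣ ×′ 1# * ∣ j ∣ ×′ 1#)
      ≈⟨ interchange _ _ _ _ ⟩
    (fromSign (sign i) * ∣ i ∣ ×′ 1#) * (fromSign (sign j) * ∣ j ∣ ×′ 1#)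
      ≈⟨ *-cong (fromℤ-signAbs i) (fromℤ-signAbs j) ⟨
    fromℤ i * fromℤ j
      ∎

  fromℤ-homomorphism : ℤ.+-*-rawRing -Raw-AlmostCommutative⟶ fromCommutativeRing R
  fromℤ-homomorphism = record
    { ⟦_⟧    = fromℤ
    ; +-homo = fromℤ-+
    ; *-homo = fromℤ-*
    ; -‿homo = fromℤ-neg
    ; 0-homo = refl
    ; 1-homo = refl
    }

  fromℤ-≟ : ∀ i j → Maybe (fromℤ i ≈ fromℤ j)
  fromℤ-≟ i j with i ℤ.≟ j
  ... | yes ≡.refl = just refl
  ... | no _       = nothing

  open Algebra.Solver.Ring ℤ.+-*-rawRing (fromCommutativeRing R) fromℤ-homomorphism fromℤ-≟ public

  polynomials : ℕ → RawRing 0ℓ 0ℓ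
  polynomials n = record
    { Carrier = Polynomial n
    ; _≈_     = _≡_
    ; _+_     = _:+_
    ; _*_     = _:*_
    ; -_      = :-_
    ; 0#      = con (+ 0)
    ; 1#      = con (+ 1)
    }

-- The coefficients of ω in logarithmic coordinates

-- Over an arbitrary raw ring, so that the same definitions serve in the
-- field and, instantiated at `polynomials n`, as input to the solver.
module LogCoefficients {c ℓ : Level} (R : RawRing c ℓ) where
  open RawRing R
  open import Algebra.Definitions.RawMonoid +-rawMonoid using (sum)

  -- ω = Σ_{p,q} A c p q (dx_p / x_p) ⊗ (dx_q / x_q).
  A : Carrier → Fin 4 → Fin 4 → Carrier
  A C = (0#   ∷ 1#         ∷ - C    ∷ 1#  ∷ [])
      ∷ (- 1# ∷ 0#         ∷ 1# + C ∷ - C ∷ [])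
      ∷ (C    ∷ - (1# + C) ∷ 0#     ∷ 1#  ∷ [])
      ∷ (- 1# ∷ C          ∷ - 1#   ∷ 0#  ∷ [])
      ∷ []

  pf : Carrier → Carrier
  pf C = (1# + 1# + - C) * (1# + C)

  adj : Carrier → Fin 4 → Fin 4 → Carrier
  adj C = (0#     ∷ - 1#   ∷ - C  ∷ - (1# + C) ∷ [])
        ∷ (1#     ∷ 0#     ∷ - 1# ∷ - C        ∷ [])
        ∷ (C      ∷ 1#     ∷ 0#   ∷ - 1#       ∷ [])
        ∷ (1# + C ∷ C      ∷ 1#   ∷ 0#         ∷ [])
        ∷ []

  A·adj : Carrier → Fin 4 → Fin 4 → Carrier
  A·adj C i j = sum λ k → A C i k * adj C k j

  I : Fin 4 → Fin 4 → Carrier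
  I i j = if does (i ≟ j) then 1# else 0#

  logForm : Carrier → (Fin 4 → Carrier) → (Fin 4 → Carrier) → Carrier
  logForm C u v = sum λ p → u p * sum λ q → A C p q * v q

  wedge : (Fin 4 → Carrier) → (Fin 4 → Carrier) → Fin 4 → Fin 4 → Carrier
  wedge u v p q = u p * v q + - (v p * u q)

  -- The shape of `ωc`, with w p q in place of dx_p∧dx_q / (x_p x_q).
  ωShape : Carrier → (Fin 4 → Fin 4 → Carrier) → Carrier
  ωShape C w = ((w 0F 1F + w 0F 3F) + w 2F 3F) + - (C * (w 0F 2F + w 1F 3F)) + (1# + C) * w 1F 2F

  -- The logarithmic differentials of the components of φ, in terms of
  -- u p = dx_p / x_p; s stands for x₁x₃ / (x₁x₃ + β x₂ᶜ).
  shift : Carrier → Carrier → (Fin 4 → Carrier) → Fin 4 → Carrier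
  shift C s u = u 1F ∷ u 2F ∷ u 3F ∷ (s * (u 1F + u 3F) + (1# + - s) * C * u 2F + - u 0F) ∷ []

  -- d log u₁ and d log u₂ in terms of u p = dx_p / x_p.
  logu₁ logu₂ : (Fin 4 → Carrier) → Carrier
  logu₁ u = (u 0F + u 2F) + - (u 1F + u 1F)
  logu₂ u = (u 1F + u 3F) + - (u 2F + u 2F)

-- Calculus in a differential field

module _ {a ℓ : Level} (K : DiffField a ℓ) where
  open DiffField K hiding (zero)
  open Forms K
  open CommutativeRing commRing using (ring)
  open import Algebra.Properties.Ring ring
    using (-0#≈0#; -1*x≈-x; -‿distribʳ-*; +-inverseʳ-unique; +-cancelˡ; x+x≈x⇒x≈0; x∙y⁻¹≈ε⇒x≈y)
  -- At each fixed length the library's `sum` unfolds to the same term as `Σ`, so its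
  -- lemmas apply to `Σ` over `Fin 4`.
  open import Algebra.Properties.Semiring.Sum semiring
    using (sum; sum-cong-≋; sum-replicate-zero; ∑-comm; ∑-distrib-+; *-distribˡ-sum; *-distribʳ-sum)
  open import Algebra.Properties.CommutativeSemigroup *-commutativeSemigroup
    using (xy∙z≈xz∙y; x∙yz≈y∙xz)
  open import Relation.Binary.Reasoning.Setoid setoid
  open IntegerCoefficients commRing
    using (Polynomial; solve; prove; _:=_; _:+_; _:*_; _:-_; :-_; con; var; polynomials)
  open LogCoefficients rawRing

  1#≉0# : 1# ≉ 0#
  1#≉0# 1≈0 = char0 0 (trans (+-identityʳ 1#) 1≈0)

  inverseˡ : ∀ {z} → z ≉ 0# → inv z * z ≈ 1#
  inverseˡ {z} z≉0 = trans (*-comm _ _) (inverseʳ z z≉0)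

  ≉0-resp-≈ : ∀ {y z} → y ≈ z → y ≉ 0# → z ≉ 0#
  ≉0-resp-≈ y≈z y≉0 z≈0 = y≉0 (trans y≈z z≈0)

  inv-unique : ∀ {z w} → z ≉ 0# → z * w ≈ 1# → w ≈ inv z
  inv-unique {z} {w} z≉0 zw≈1 = begin
    w                ≈⟨ *-identityˡ w ⟨
    1# * w           ≈⟨ *-congʳ (inverseˡ z≉0) ⟨
    (inv z * z) * w  ≈⟨ *-assoc _ _ _ ⟩
    inv z * (z * w)  ≈⟨ *-congˡ zw≈1 ⟩
    inv z * 1#       ≈⟨ *-identityʳ _ ⟩
    inv z            ∎

  inv-cong : ∀ {y z} → y ≉ 0# → y ≈ z → inv y ≈ inv z
  inv-cong {y} y≉0 y≈z =
    inv-unique (≉0-resp-≈ y≈z y≉0) (trans (*-congʳ (sym y≈z)) (inverseʳ y y≉0))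

  *-≉0 : ∀ {y z} → y ≉ 0# → z ≉ 0# → y * z ≉ 0#
  *-≉0 {y} {z} y≉0 z≉0 yz≈0 = z≉0 (begin
    z                ≈⟨ *-identityˡ z ⟨
    1# * z           ≈⟨ *-congʳ (inverseˡ y≉0) ⟨
    (inv y * y) * z  ≈⟨ *-assoc _ _ _ ⟩
    inv y * (y * z)  ≈⟨ *-congˡ yz≈0 ⟩
    inv y * 0#       ≈⟨ zeroʳ _ ⟩
    0#               ∎)

  inv-≉0 : ∀ {z} → z ≉ 0# → inv z ≉ 0#
  inv-≉0 {z} z≉0 inv≈0 = 1#≉0# (begin
    1#          ≈⟨ inverseʳ z z≉0 ⟨
    z * inv z   ≈⟨ *-congˡ inv≈0 ⟩
    z * 0#      ≈⟨ zeroʳ z ⟩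
    0#          ∎)

  ι-injective : ∀ m n → ι m ≈ ι n → m ≡ n
  ι-injective zero    zero    _   = ≡.refl
  ι-injective zero    (suc n) 0≈ι = contradiction (sym 0≈ι) (char0 n)
  ι-injective (suc m) zero    ι≈0 = contradiction ι≈0 (char0 m)
  ι-injective (suc m) (suc n) ι≈ι = ≡.cong suc (ι-injective m n (+-cancelˡ 1# _ _ ι≈ι))

  sum-δʳ : ∀ {n} (f : Fin n → Carrier) i → sum (λ p → f p * δ i p) ≈ f i
  sum-δʳ {suc n} f zero = begin
    f zero * 1# + sum (λ p → f (suc p) * 0#)  ≈⟨ +-cong (*-identityʳ _) (sum-cong-≋ {n} (λ p → zeroʳ _)) ⟩
    f zero + sum {n} (λ _ → 0#)               ≈⟨ +-congˡ (sum-replicate-zero n) ⟩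
    f zero + 0#                               ≈⟨ +-identityʳ _ ⟩
    f zero                                    ∎
  sum-δʳ f (suc i) = trans (+-cong (zeroʳ _) (sum-δʳ (f ∘ suc) i)) (+-identityˡ _)

  δ-comm : ∀ {n} (i j : Fin n) → δ i j ≈ δ j i
  δ-comm i j with i ≟ j | j ≟ i
  ... | yes _    | yes _    = refl
  ... | no  _    | no  _    = refl
  ... | yes i≡j  | no  j≢i  = contradiction (≡.sym i≡j) j≢i
  ... | no  i≢j  | yes j≡i  = contradiction (≡.sym j≡i) i≢j

  sum-δˡ : ∀ {n} (f : Fin n → Carrier) i → sum (λ p → f p * δ p i) ≈ f i
  sum-δˡ f i = trans (sum-cong-≋ (λ p → *-congˡ (δ-comm p i))) (sum-δʳ f i)

  Constant : Carrier → Set ℓ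
  Constant z = ∀ k → ∂ k z ≈ 0#

  ∂-0# : Constant 0#
  ∂-0# k = x+x≈x⇒x≈0 (∂ k 0#) (sym (trans (∂-cong k (sym (+-identityʳ 0#))) (∂-+ k 0# 0#)))

  ∂-1# : Constant 1#
  ∂-1# k = x+x≈x⇒x≈0 (∂ k 1#) (sym (begin
    ∂ k 1#                     ≈⟨ ∂-cong k (*-identityʳ 1#) ⟨
    ∂ k (1# * 1#)              ≈⟨ ∂-* k 1# 1# ⟩
    ∂ k 1# * 1# + 1# * ∂ k 1#  ≈⟨ +-cong (*-identityʳ _) (*-identityˡ _) ⟩
    ∂ k 1# + ∂ k 1#            ∎))

  ∂-ι : ∀ n → Constant (ι n)
  ∂-ι zero    = ∂-0#
  ∂-ι (suc n) k = trans (∂-+ k 1# (ι n)) (trans (+-cong (∂-1# k) (∂-ι n k)) (+-identityʳ 0#))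

  ∂-δ : ∀ {n} (i j : Fin n) → Constant (δ i j)
  ∂-δ i j with does (i ≟ j)
  ... | true  = ∂-1#
  ... | false = ∂-0#

  ∂-‿ : ∀ k y → ∂ k (- y) ≈ - ∂ k y
  ∂-‿ k y = +-inverseʳ-unique (∂ k y) (∂ k (- y)) (begin
    ∂ k y + ∂ k (- y)  ≈⟨ ∂-+ k y (- y) ⟨
    ∂ k (y - y)        ≈⟨ ∂-cong k (-‿inverseʳ y) ⟩
    ∂ k 0#             ≈⟨ ∂-0# k ⟩
    0#                 ∎)

  ∂-sub : ∀ k y z → ∂ k (y - z) ≈ ∂ k y - ∂ k z
  ∂-sub k y z = trans (∂-+ k y (- z)) (+-congˡ (∂-‿ k z))

  ∂-constant-* : ∀ {b} → Constant b → ∀ k y → ∂ k (b * y) ≈ b * ∂ k y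
  ∂-constant-* {b} b-constant k y = begin
    ∂ k (b * y)              ≈⟨ ∂-* k b y ⟩
    ∂ k b * y + b * ∂ k y    ≈⟨ +-congʳ (trans (*-congʳ (b-constant k)) (zeroˡ y)) ⟩
    0# + b * ∂ k y           ≈⟨ +-identityˡ _ ⟩
    b * ∂ k y                ∎

  ≉0-from-∂ : ∀ {z} k → ∂ k z ≉ 0# → z ≉ 0#
  ≉0-from-∂ k ∂z≉0 z≈0 = ∂z≉0 (trans (∂-cong k z≈0) (∂-0# k))

  dlog : Carrier → OneForm
  dlog z k = inv z * ∂ k z

  ∂≈*dlog : ∀ {z} → z ≉ 0# → ∀ k → ∂ k z ≈ z * dlog z k
  ∂≈*dlog {z} z≉0 k = begin
    ∂ k z                  ≈⟨ *-identityˡ _ ⟨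
    1# * ∂ k z             ≈⟨ *-congʳ (inverseʳ z z≉0) ⟨
    (z * inv z) * ∂ k z    ≈⟨ *-assoc _ _ _ ⟩
    z * dlog z k           ∎

  dlog-unique : ∀ {z w} k → z ≉ 0# → z * w ≈ ∂ k z → w ≈ dlog z k
  dlog-unique {z} {w} k z≉0 zw≈∂z = begin
    w                ≈⟨ *-identityˡ w ⟨
    1# * w           ≈⟨ *-congʳ (inverseˡ z≉0) ⟨
    (inv z * z) * w  ≈⟨ *-assoc _ _ _ ⟩
    inv z * (z * w)  ≈⟨ *-congˡ zw≈∂z ⟩
    dlog z k         ∎

  dlog-cong : ∀ {y z} → y ≉ 0# → y ≈ z → ∀ k → dlog y k ≈ dlog z k
  dlog-cong y≉0 y≈z k = *-cong (inv-cong y≉0 y≈z) (∂-cong k y≈z)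

  dlog-1# : ∀ k → dlog 1# k ≈ 0#
  dlog-1# k = trans (*-congˡ (∂-1# k)) (zeroʳ _)

  dlog-* : ∀ {y z} → y ≉ 0# → z ≉ 0# → ∀ k → dlog (y * z) k ≈ dlog y k + dlog z k
  dlog-* {y} {z} y≉0 z≉0 k = sym (dlog-unique k (*-≉0 y≉0 z≉0) (begin
    (y * z) * (dlog y k + dlog z k)          ≈⟨ solve 4 (λ y z a b → (y :* z) :* (a :+ b) := (y :* a) :* z :+ y :* (z :* b))
                                                  refl y z (dlog y k) (dlog z k) ⟩
    (y * dlog y k) * z + y * (z * dlog z k)  ≈⟨ +-cong (*-congʳ (∂≈*dlog y≉0 k)) (*-congˡ (∂≈*dlog z≉0 k)) ⟨
    ∂ k y * z + y * ∂ k z                    ≈⟨ ∂-* k y z ⟨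
    ∂ k (y * z)                              ∎))

  dlog-inv : ∀ {z} → z ≉ 0# → ∀ k → dlog (inv z) k ≈ - dlog z k
  dlog-inv {z} z≉0 k = +-inverseʳ-unique (dlog z k) (dlog (inv z) k) (begin
    dlog z k + dlog (inv z) k  ≈⟨ dlog-* z≉0 (inv-≉0 z≉0) k ⟨
    dlog (z * inv z) k         ≈⟨ dlog-cong (*-≉0 z≉0 (inv-≉0 z≉0)) (inverseʳ z z≉0) k ⟩
    dlog 1# k                  ≈⟨ dlog-1# k ⟩
    0#                         ∎)

  pow-≉0 : ∀ {y} n → y ≉ 0# → pow y n ≉ 0#
  pow-≉0 zero    y≉0 = 1#≉0#
  pow-≉0 (suc n) y≉0 = *-≉0 y≉0 (pow-≉0 n y≉0)

  dlog-pow : ∀ {y} n → y ≉ 0# → ∀ k → dlog (pow y n) k ≈ ι n * dlog y k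
  dlog-pow zero    y≉0 k = trans (dlog-1# k) (sym (zeroˡ _))
  dlog-pow {y} (suc n) y≉0 k = begin
    dlog (y * pow y n) k               ≈⟨ dlog-* y≉0 (pow-≉0 n y≉0) k ⟩
    dlog y k + dlog (pow y n) k        ≈⟨ +-cong (sym (*-identityˡ _)) (dlog-pow n y≉0 k) ⟩
    1# * dlog y k + ι n * dlog y k     ≈⟨ distribʳ _ _ _ ⟨
    (1# + ι n) * dlog y k              ∎

  ∂-dlog : ∀ {y} → y ≉ 0# → ∀ i j → ∂ i (dlog y j) ≈ inv y * ∂ i (∂ j y) - dlog y i * dlog y j
  ∂-dlog {y} y≉0 i j = begin
    ∂ i (inv y * ∂ j y)                                 ≈⟨ ∂-* i (inv y) (∂ j y) ⟩
    ∂ i (inv y) * ∂ j y + inv y * ∂ i (∂ j y)           ≈⟨ +-congʳ (*-congʳ (∂≈*dlog (inv-≉0 y≉0) i)) ⟩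
    (inv y * dlog (inv y) i) * ∂ j y + inv y * ∂ i (∂ j y)
      ≈⟨ +-congʳ (*-congʳ (*-congˡ (dlog-inv y≉0 i))) ⟩
    (inv y * - dlog y i) * ∂ j y + inv y * ∂ i (∂ j y)
      ≈⟨ solve 4 (λ iy a dj b → (iy :* :- a) :* dj :+ iy :* b := iy :* b :- a :* (iy :* dj))
           refl (inv y) (dlog y i) (∂ j y) (∂ i (∂ j y)) ⟩
    inv y * ∂ i (∂ j y) - dlog y i * dlog y j           ∎

  -- Closed forms

  d₁ : OneForm → TwoForm
  d₁ α i j = ∂ i (α j) - ∂ j (α i)

  ClosedOneForm : OneForm → Set ℓ
  ClosedOneForm α = ∀ i j → d₁ α i j ≈ 0#

  d₂ : TwoForm → Fin 4 → Fin 4 → Fin 4 → Carrier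
  d₂ Ω i j k = ∂ i (Ω j k) + ∂ j (Ω k i) + ∂ k (Ω i j)

  dlog-closed : ∀ {y} → y ≉ 0# → (∀ i j → ∂ i (∂ j y) ≈ ∂ j (∂ i y)) → ClosedOneForm (dlog y)
  dlog-closed {y} y≉0 ∂∂-comm i j = begin
    ∂ i (dlog y j) - ∂ j (dlog y i)
      ≈⟨ +-cong (∂-dlog y≉0 i j) (-‿cong (∂-dlog y≉0 j i)) ⟩
    (inv y * ∂ i (∂ j y) - dlog y i * dlog y j) - (inv y * ∂ j (∂ i y) - dlog y j * dlog y i)
      ≈⟨ +-congˡ (-‿cong (+-congʳ (*-congˡ (∂∂-comm i j)))) ⟨
    (inv y * ∂ i (∂ j y) - dlog y i * dlog y j) - (inv y * ∂ i (∂ j y) - dlog y j * dlog y i)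
      ≈⟨ solve 4 (λ iy b u v → (iy :* b :- u :* v) :- (iy :* b :- v :* u) := con (+ 0))
           refl (inv y) (∂ i (∂ j y)) (dlog y i) (dlog y j) ⟩
    0#
      ∎

  d₂-⊕ : ∀ ω η i j k → d₂ (ω ⊕ η) i j k ≈ d₂ ω i j k + d₂ η i j k
  d₂-⊕ ω η i j k = begin
    ∂ i (ω j k + η j k) + ∂ j (ω k i + η k i) + ∂ k (ω i j + η i j)
      ≈⟨ +-cong (+-cong (∂-+ i _ _) (∂-+ j _ _)) (∂-+ k _ _) ⟩
    (∂ i (ω j k) + ∂ i (η j k)) + (∂ j (ω k i) + ∂ j (η k i)) + (∂ k (ω i j) + ∂ k (η i j))
      ≈⟨ solve 6 (λ a a′ b b′ c c′ → (a :+ a′) :+ (b :+ b′) :+ (c :+ c′) := (a :+ b :+ c) :+ (a′ :+ b′ :+ c′))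
                 refl _ _ _ _ _ _ ⟩
    d₂ ω i j k + d₂ η i j k
      ∎

  d₂-⊖ : ∀ ω η i j k → d₂ (ω ⊖ η) i j k ≈ d₂ ω i j k - d₂ η i j k
  d₂-⊖ ω η i j k = begin
    ∂ i (ω j k - η j k) + ∂ j (ω k i - η k i) + ∂ k (ω i j - η i j)
      ≈⟨ +-cong (+-cong (∂-sub i _ _) (∂-sub j _ _)) (∂-sub k _ _) ⟩
    (∂ i (ω j k) - ∂ i (η j k)) + (∂ j (ω k i) - ∂ j (η k i)) + (∂ k (ω i j) - ∂ k (η i j))
      ≈⟨ solve 6 (λ a a′ b b′ c c′ → (a :- a′) :+ (b :- b′) :+ (c :- c′) := (a :+ b :+ c) :- (a′ :+ b′ :+ c′))
                 refl _ _ _ _ _ _ ⟩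
    d₂ ω i j k - d₂ η i j k
      ∎

  d₂-· : ∀ {b} → Constant b → ∀ ω i j k → d₂ (b · ω) i j k ≈ b * d₂ ω i j k
  d₂-· {b} b-constant ω i j k = begin
    ∂ i (b * ω j k) + ∂ j (b * ω k i) + ∂ k (b * ω i j)
      ≈⟨ +-cong (+-cong (∂-constant-* b-constant i _) (∂-constant-* b-constant j _)) (∂-constant-* b-constant k _) ⟩
    b * ∂ i (ω j k) + b * ∂ j (ω k i) + b * ∂ k (ω i j)
      ≈⟨ solve 4 (λ b x y z → b :* x :+ b :* y :+ b :* z := b :* (x :+ y :+ z)) refl b _ _ _ ⟩
    b * d₂ ω i j k
      ∎

  Closed-⊕ : ∀ {ω η} → Closed ω → Closed η → Closed (ω ⊕ η)
  Closed-⊕ {ω} {η} dω≈0 dη≈0 i j k =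
    trans (d₂-⊕ ω η i j k) (trans (+-cong (dω≈0 i j k) (dη≈0 i j k)) (+-identityʳ 0#))

  Closed-⊖ : ∀ {ω η} → Closed ω → Closed η → Closed (ω ⊖ η)
  Closed-⊖ {ω} {η} dω≈0 dη≈0 i j k =
    trans (d₂-⊖ ω η i j k) (trans (+-cong (dω≈0 i j k) (trans (-‿cong (dη≈0 i j k)) -0#≈0#)) (+-identityʳ 0#))

  Closed-· : ∀ {b ω} → Constant b → Closed ω → Closed (b · ω)
  Closed-· {b} {ω} b-constant dω≈0 i j k =
    trans (d₂-· b-constant ω i j k) (trans (*-congˡ (dω≈0 i j k)) (zeroʳ b))

  Closed-resp-≈₂ : ∀ {ω η} → ω ≈₂ η → Closed ω → Closed η
  Closed-resp-≈₂ ω≈η dω≈0 i j k = trans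
    (+-cong (+-cong (∂-cong i (sym (ω≈η j k))) (∂-cong j (sym (ω≈η k i)))) (∂-cong k (sym (ω≈η i j))))
    (dω≈0 i j k)

  ∂-∧ : ∀ (α β : OneForm) i j k →
        ∂ i ((α ∧ β) j k) ≈ (∂ i (α j) * β k + α j * ∂ i (β k)) - (∂ i (α k) * β j + α k * ∂ i (β j))
  ∂-∧ α β i j k = trans (∂-sub i _ _) (+-cong (∂-* i _ _) (-‿cong (∂-* i _ _)))

  d₂-∧ : ∀ (α β : OneForm) i j k → d₂ (α ∧ β) i j k ≈
         (d₁ α i j * β k + d₁ α j k * β i + d₁ α k i * β j) - (α k * d₁ β i j + α i * d₁ β j k + α j * d₁ β k i)
  d₂-∧ α β i j k = trans (+-cong (+-cong (∂-∧ α β i j k) (∂-∧ α β j k i)) (∂-∧ α β k i j))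
    (solve 18 (λ αi αj αk βi βj βk ∂iαj ∂iαk ∂jαk ∂jαi ∂kαi ∂kαj ∂iβj ∂iβk ∂jβk ∂jβi ∂kβi ∂kβj →
        ((∂iαj :* βk :+ αj :* ∂iβk) :- (∂iαk :* βj :+ αk :* ∂iβj))
        :+ ((∂jαk :* βi :+ αk :* ∂jβi) :- (∂jαi :* βk :+ αi :* ∂jβk))
        :+ ((∂kαi :* βj :+ αi :* ∂kβj) :- (∂kαj :* βi :+ αj :* ∂kβi))
      := ((∂iαj :- ∂jαi) :* βk :+ (∂jαk :- ∂kαj) :* βi :+ (∂kαi :- ∂iαk) :* βj)
         :- (αk :* (∂iβj :- ∂jβi) :+ αi :* (∂jβk :- ∂kβj) :+ αj :* (∂kβi :- ∂iβk)))
      refl (α i) (α j) (α k) (β i) (β j) (β k)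
           (∂ i (α j)) (∂ i (α k)) (∂ j (α k)) (∂ j (α i)) (∂ k (α i)) (∂ k (α j))
           (∂ i (β j)) (∂ i (β k)) (∂ j (β k)) (∂ j (β i)) (∂ k (β i)) (∂ k (β j)))

  ∧-closed : ∀ {α β} → ClosedOneForm α → ClosedOneForm β → Closed (α ∧ β)
  ∧-closed {α} {β} dα≈0 dβ≈0 i j k = begin
    d₂ (α ∧ β) i j k
      ≈⟨ d₂-∧ α β i j k ⟩
    (d₁ α i j * β k + d₁ α j k * β i + d₁ α k i * β j) - (α k * d₁ β i j + α i * d₁ β j k + α j * d₁ β k i)
      ≈⟨ +-cong (+-cong (+-cong (vanishˡ (dα≈0 i j)) (vanishˡ (dα≈0 j k))) (vanishˡ (dα≈0 k i)))
                (-‿cong (+-cong (+-cong (vanishʳ (dβ≈0 i j)) (vanishʳ (dβ≈0 j k))) (vanishʳ (dβ≈0 k i)))) ⟩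
    (0# + 0# + 0#) - (0# + 0# + 0#)
      ≈⟨ -‿inverseʳ _ ⟩
    0#
      ∎
    where
    vanishˡ : ∀ {y z} → y ≈ 0# → y * z ≈ 0#
    vanishˡ {z = z} y≈0 = trans (*-congʳ y≈0) (zeroˡ z)
    vanishʳ : ∀ {y z} → z ≈ 0# → y * z ≈ 0#
    vanishʳ {y} z≈0 = trans (*-congˡ z≈0) (zeroʳ y)

  log-wedge : ∀ {y z} → y ≉ 0# → z ≉ 0# → (inv (y * z) · (d y ∧ d z)) ≈₂ (dlog y ∧ dlog z)
  log-wedge {y} {z} y≉0 z≉0 i j = begin
    inv (y * z) * (∂ i y * ∂ j z - ∂ j y * ∂ i z)
      ≈⟨ *-congˡ (+-cong (*-cong (∂≈*dlog y≉0 i) (∂≈*dlog z≉0 j))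
                         (-‿cong (*-cong (∂≈*dlog y≉0 j) (∂≈*dlog z≉0 i)))) ⟩
    inv (y * z) * ((y * dlog y i) * (z * dlog z j) - (y * dlog y j) * (z * dlog z i))
      ≈⟨ solve 7 (λ w y z a b a′ b′ → w :* ((y :* a) :* (z :* b) :- (y :* a′) :* (z :* b′))
                                     := (w :* (y :* z)) :* (a :* b :- a′ :* b′))
           refl (inv (y * z)) y z (dlog y i) (dlog z j) (dlog y j) (dlog z i) ⟩
    (inv (y * z) * (y * z)) * (dlog y i * dlog z j - dlog y j * dlog z i)
      ≈⟨ *-congʳ (inverseˡ (*-≉0 y≉0 z≉0)) ⟩
    1# * (dlog y i * dlog z j - dlog y j * dlog z i)
      ≈⟨ *-identityˡ _ ⟩
    dlog y i * dlog z j - dlog y j * dlog z i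
      ∎

  ωc-closed : ∀ c {y} → (∀ p → y p ≉ 0#) → (∀ p → ClosedOneForm (dlog (y p))) → Closed (ωc c y)
  ωc-closed c {y} y≉0 dlog-y-closed =
    Closed-⊕ (Closed-⊖ (Closed-⊕ (Closed-⊕ (L-closed 0F 1F) (L-closed 0F 3F)) (L-closed 2F 3F))
                       (Closed-· (∂-ι c) (Closed-⊕ (L-closed 0F 2F) (L-closed 1F 3F))))
             (Closed-· (∂-ι (suc c)) (L-closed 1F 2F))
    where
    L-closed : ∀ p q → Closed (L y p q)
    L-closed p q = Closed-resp-≈₂ (λ i j → sym (log-wedge (y≉0 p) (y≉0 q) i j))
                                  (∧-closed (dlog-y-closed p) (dlog-y-closed q))

  -- ω as a bilinear form in the logarithmic differentials

  ωShape-cong : ∀ C {w w′} → (∀ p q → w p q ≈ w′ p q) → ωShape C w ≈ ωShape C w′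
  ωShape-cong C w≈w′ =
    +-cong (+-cong (+-cong (+-cong (w≈w′ 0F 1F) (w≈w′ 0F 3F)) (w≈w′ 2F 3F))
                   (-‿cong (*-congˡ (+-cong (w≈w′ 0F 2F) (w≈w′ 1F 3F)))))
           (*-congˡ (w≈w′ 1F 2F))

  logForm-cong : ∀ C {u u′ v v′} → (∀ p → u p ≈ u′ p) → (∀ q → v q ≈ v′ q) → logForm C u v ≈ logForm C u′ v′
  logForm-cong C u≈u′ v≈v′ = sum-cong-≋ (λ p → *-cong (u≈u′ p) (sum-cong-≋ (λ q → *-congˡ {A C p q} (v≈v′ q))))

  ωShape-wedge : ∀ C u v → ωShape C (wedge u v) ≈ logForm C u v
  ωShape-wedge C u v = solve 9 (λ C u₀ u₁ u₂ u₃ v₀ v₁ v₂ v₃ →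
      P.ωShape C (P.wedge (u₀ ∷ u₁ ∷ u₂ ∷ u₃ ∷ []) (v₀ ∷ v₁ ∷ v₂ ∷ v₃ ∷ []))
      := P.logForm C (u₀ ∷ u₁ ∷ u₂ ∷ u₃ ∷ []) (v₀ ∷ v₁ ∷ v₂ ∷ v₃ ∷ []))
    refl C (u 0F) (u 1F) (u 2F) (u 3F) (v 0F) (v 1F) (v 2F) (v 3F)
    where module P = LogCoefficients (polynomials 9)

  ωc≈logForm : ∀ c {y} → (∀ p → y p ≉ 0#) → ∀ i j →
               ωc c y i j ≈ logForm (ι c) (λ p → dlog (y p) i) (λ q → dlog (y q) j)
  ωc≈logForm c {y} y≉0 i j =
    trans (ωShape-cong (ι c) (λ p q → log-wedge (y≉0 p) (y≉0 q) i j))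
          (ωShape-wedge (ι c) (λ p → dlog (y p) i) (λ q → dlog (y q) j))

  logForm-shift : ∀ C s u v → logForm C (shift C s u) (shift C s v) ≈ logForm C u v
  logForm-shift C s u v = solve 10 (λ C s u₀ u₁ u₂ u₃ v₀ v₁ v₂ v₃ →
      P.logForm C (P.shift C s (u₀ ∷ u₁ ∷ u₂ ∷ u₃ ∷ [])) (P.shift C s (v₀ ∷ v₁ ∷ v₂ ∷ v₃ ∷ []))
      := P.logForm C (u₀ ∷ u₁ ∷ u₂ ∷ u₃ ∷ []) (v₀ ∷ v₁ ∷ v₂ ∷ v₃ ∷ []))
    refl C s (u 0F) (u 1F) (u 2F) (u 3F) (v 0F) (v 1F) (v 2F) (v 3F)
    where module P = LogCoefficients (polynomials 10)

  logForm-ι2 : ∀ u v → logForm (ι 2) u v ≈ logu₁ u * logu₂ v - logu₁ v * logu₂ u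
  logForm-ι2 u v = solve 8 (λ u₀ u₁ u₂ u₃ v₀ v₁ v₂ v₃ →
      -- ι 2 unfolds to 1# + (1# + 0#)
      P.logForm (con (+ 1) :+ (con (+ 1) :+ con (+ 0))) (u₀ ∷ u₁ ∷ u₂ ∷ u₃ ∷ []) (v₀ ∷ v₁ ∷ v₂ ∷ v₃ ∷ [])
      := P.logu₁ (u₀ ∷ u₁ ∷ u₂ ∷ u₃ ∷ []) :* P.logu₂ (v₀ ∷ v₁ ∷ v₂ ∷ v₃ ∷ [])
         :- P.logu₁ (v₀ ∷ v₁ ∷ v₂ ∷ v₃ ∷ []) :* P.logu₂ (u₀ ∷ u₁ ∷ u₂ ∷ u₃ ∷ []))
    refl (u 0F) (u 1F) (u 2F) (u 3F) (v 0F) (v 1F) (v 2F) (v 3F)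
    where module P = LogCoefficients (polynomials 8)

  -- Nondegeneracy

  A·adj≈pf·δ : ∀ C i j → A·adj C i j ≈ pf C * δ i j
  A·adj≈pf·δ C = entry
    where
    module P = LogCoefficients (polynomials 1)
    ρ : Vec.Vec Carrier 1
    ρ = C Vec.∷ Vec.[]
    lhs rhs : Fin 4 → Fin 4 → Polynomial 1
    lhs i j = P.A·adj (var 0F) i j
    rhs i j = P.pf (var 0F) :* P.I i j
    entry : ∀ i j → A·adj C i j ≈ pf C * δ i j
    entry 0F 0F = prove ρ (lhs 0F 0F) (rhs 0F 0F) refl
    entry 0F 1F = prove ρ (lhs 0F 1F) (rhs 0F 1F) refl
    entry 0F 2F = prove ρ (lhs 0F 2F) (rhs 0F 2F) refl
    entry 0F 3F = prove ρ (lhs 0F 3F) (rhs 0F 3F) refl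
    entry 1F 0F = prove ρ (lhs 1F 0F) (rhs 1F 0F) refl
    entry 1F 1F = prove ρ (lhs 1F 1F) (rhs 1F 1F) refl
    entry 1F 2F = prove ρ (lhs 1F 2F) (rhs 1F 2F) refl
    entry 1F 3F = prove ρ (lhs 1F 3F) (rhs 1F 3F) refl
    entry 2F 0F = prove ρ (lhs 2F 0F) (rhs 2F 0F) refl
    entry 2F 1F = prove ρ (lhs 2F 1F) (rhs 2F 1F) refl
    entry 2F 2F = prove ρ (lhs 2F 2F) (rhs 2F 2F) refl
    entry 2F 3F = prove ρ (lhs 2F 3F) (rhs 2F 3F) refl
    entry 3F 0F = prove ρ (lhs 3F 0F) (rhs 3F 0F) refl
    entry 3F 1F = prove ρ (lhs 3F 1F) (rhs 3F 1F) refl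
    entry 3F 2F = prove ρ (lhs 3F 2F) (rhs 3F 2F) refl
    entry 3F 3F = prove ρ (lhs 3F 3F) (rhs 3F 3F) refl

  congruent-nondegenerate : ∀ {Ω} (D : Fin 4 → Carrier) (B M : Fin 4 → Fin 4 → Carrier) →
    (∀ i → D i ≉ 0#) → (∀ i k → Ω i k ≈ D i * (B i k * D k)) →
    (∀ i j → Σ (λ k → B i k * M k j) ≈ δ i j) → Nondegenerate Ω
  congruent-nondegenerate {Ω} D B M D≉0 Ω≈DBD BM≈I = N , ΩN≈I
    where
    N : Fin 4 → Fin 4 → Carrier
    N k j = inv (D k) * (M k j * inv (D j))

    cancel-D : ∀ i j k → Ω i k * N k j ≈ D i * ((B i k * M k j) * inv (D j))
    cancel-D i j k = begin
      Ω i k * N k j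
        ≈⟨ *-congʳ (Ω≈DBD i k) ⟩
      (D i * (B i k * D k)) * (inv (D k) * (M k j * inv (D j)))
        ≈⟨ solve 6 (λ di b dk ik m ij → (di :* (b :* dk)) :* (ik :* (m :* ij)) := (dk :* ik) :* (di :* ((b :* m) :* ij)))
             refl (D i) (B i k) (D k) (inv (D k)) (M k j) (inv (D j)) ⟩
      (D k * inv (D k)) * (D i * ((B i k * M k j) * inv (D j)))
        ≈⟨ trans (*-congʳ (inverseʳ (D k) (D≉0 k))) (*-identityˡ _) ⟩
      D i * ((B i k * M k j) * inv (D j))
        ∎

    δ-rescaled : ∀ i j → D i * (δ i j * inv (D j)) ≈ δ i j
    δ-rescaled i j with i ≟ j
    ... | yes ≡.refl = trans (*-congˡ (*-identityˡ _)) (inverseʳ (D i) (D≉0 i))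
    ... | no  _      = trans (*-congˡ (zeroˡ _)) (zeroʳ _)

    ΩN≈I : ∀ i j → Σ (λ k → Ω i k * N k j) ≈ δ i j
    ΩN≈I i j = begin
      Σ (λ k → Ω i k * N k j)                              ≈⟨ sum-cong-≋ {4} (cancel-D i j) ⟩
      Σ (λ k → D i * ((B i k * M k j) * inv (D j)))        ≈⟨ *-distribˡ-sum (D i) (λ k → (B i k * M k j) * inv (D j)) ⟨
      D i * Σ (λ k → (B i k * M k j) * inv (D j))          ≈⟨ *-congˡ (*-distribʳ-sum (inv (D j)) (λ k → B i k * M k j)) ⟨
      D i * (Σ (λ k → B i k * M k j) * inv (D j))          ≈⟨ *-congˡ (*-congʳ (BM≈I i j)) ⟩
      D i * (δ i j * inv (D j))                            ≈⟨ δ-rescaled i j ⟩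
      δ i j                                                ∎

  kernel⇒degenerate : ∀ {Ω} (v : Fin 4 → Carrier) i → v i ≉ 0# →
                      (∀ k → Σ (λ j → v j * Ω j k) ≈ 0#) → ¬ Nondegenerate Ω
  kernel⇒degenerate {Ω} v i vi≉0 vΩ≈0 (N , ΩN≈I) = vi≉0 (begin
    v i                                        ≈⟨ sum-δˡ v i ⟨
    Σ (λ j → v j * δ j i)                      ≈⟨ sum-cong-≋ {4} (λ j → *-congˡ {v j} (ΩN≈I j i)) ⟨
    Σ (λ j → v j * Σ (λ k → Ω j k * N k i))    ≈⟨ sum-cong-≋ {4} (λ j → *-distribˡ-sum (v j) (λ k → Ω j k * N k i)) ⟩
    Σ (λ j → Σ (λ k → v j * (Ω j k * N k i)))  ≈⟨ ∑-comm (λ j k → v j * (Ω j k * N k i)) ⟩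
    Σ (λ k → Σ (λ j → v j * (Ω j k * N k i)))  ≈⟨ sum-cong-≋ {4} (λ k → sum-cong-≋ {4} (λ j → *-assoc (v j) (Ω j k) (N k i))) ⟨
    Σ (λ k → Σ (λ j → (v j * Ω j k) * N k i))  ≈⟨ sum-cong-≋ {4} (λ k → *-distribʳ-sum (N k i) (λ j → v j * Ω j k)) ⟨
    Σ (λ k → Σ (λ j → v j * Ω j k) * N k i)    ≈⟨ sum-cong-≋ {4} (λ k → trans (*-congʳ (vΩ≈0 k)) (zeroˡ (N k i))) ⟩
    Σ {4} (λ _ → 0#)                           ≈⟨ sum-replicate-zero 4 ⟩
    0#                                         ∎)

  contract : (Fin 4 → Carrier) → OneForm → Carrier
  contract v α = Σ λ j → v j * α j

  contract-+ : ∀ v α β → contract v (λ j → α j + β j) ≈ contract v α + contract v β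
  contract-+ v α β = trans (sum-cong-≋ {4} (λ j → distribˡ (v j) (α j) (β j)))
                           (∑-distrib-+ (λ j → v j * α j) (λ j → v j * β j))

  contract-‿ : ∀ v α → contract v (λ j → - α j) ≈ - contract v α
  contract-‿ v α = begin
    Σ (λ j → v j * - α j)           ≈⟨ sum-cong-≋ {4} (λ j → trans (sym (-‿distribʳ-* (v j) (α j))) (sym (-1*x≈-x (v j * α j)))) ⟩
    Σ (λ j → - 1# * (v j * α j))    ≈⟨ *-distribˡ-sum (- 1#) (λ j → v j * α j) ⟨
    - 1# * contract v α             ≈⟨ -1*x≈-x _ ⟩
    - contract v α                  ∎

  ∧-kernel : ∀ v α β → contract v α ≈ 0# → contract v β ≈ 0# → ∀ k → Σ (λ j → v j * (α ∧ β) j k) ≈ 0#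
  ∧-kernel v α β vα≈0 vβ≈0 k = begin
    Σ (λ j → v j * (α j * β k - α k * β j))
      ≈⟨ sum-cong-≋ {4} (λ j → solve 5 (λ v a b a′ b′ → v :* (a :* b′ :- a′ :* b) := (v :* a) :* b′ :+ (:- a′) :* (v :* b))
                                 refl (v j) (α j) (β j) (α k) (β k)) ⟩
    Σ (λ j → (v j * α j) * β k + - α k * (v j * β j))
      ≈⟨ ∑-distrib-+ (λ j → (v j * α j) * β k) (λ j → - α k * (v j * β j)) ⟩
    Σ (λ j → (v j * α j) * β k) + Σ (λ j → - α k * (v j * β j))
      ≈⟨ +-cong (*-distribʳ-sum (β k) (λ j → v j * α j)) (*-distribˡ-sum (- α k) (λ j → v j * β j)) ⟨
    contract v α * β k + - α k * contract v β
      ≈⟨ +-cong (trans (*-congʳ vα≈0) (zeroˡ _)) (trans (*-congˡ vβ≈0) (zeroʳ _)) ⟩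
    0# + 0#
      ≈⟨ +-identityʳ 0# ⟩
    0#
      ∎

  logForm-δ : ∀ C (e : Fin 4 → Carrier) i k →
              logForm C (λ p → e p * δ i p) (λ q → e q * δ k q) ≈ e i * (A C i k * e k)
  logForm-δ C e i k = begin
    Σ (λ p → (e p * δ i p) * Σ (λ q → A C p q * (e q * δ k q)))
      ≈⟨ sum-cong-≋ {4} (λ p → *-congˡ {e p * δ i p} (sum-cong-≋ {4} (λ q → *-assoc (A C p q) (e q) (δ k q)))) ⟨
    Σ (λ p → (e p * δ i p) * Σ (λ q → (A C p q * e q) * δ k q))
      ≈⟨ sum-cong-≋ {4} (λ p → *-congˡ {e p * δ i p} (sum-δʳ (λ q → A C p q * e q) k)) ⟩
    Σ (λ p → (e p * δ i p) * (A C p k * e k))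
      ≈⟨ sum-cong-≋ {4} (λ p → xy∙z≈xz∙y (e p) (δ i p) (A C p k * e k)) ⟩
    Σ (λ p → (e p * (A C p k * e k)) * δ i p)
      ≈⟨ sum-δʳ (λ p → e p * (A C p k * e k)) i ⟩
    e i * (A C i k * e k)
      ∎

  pf≉0 : ∀ c → c ≢ 2 → pf (ι c) ≉ 0#
  pf≉0 c c≢2 = *-≉0 2-c≉0 (char0 c)
    where
    2-c≉0 : 1# + 1# + - ι c ≉ 0#
    2-c≉0 2-c≈0 = c≢2 (≡.sym (ι-injective 2 c (trans (+-congˡ (+-identityʳ 1#)) (x∙y⁻¹≈ε⇒x≈y _ _ 2-c≈0))))

  dlog-ratio : ∀ {w y z t} → w ≉ 0# → y ≉ 0# → z ≉ 0# → t ≉ 0# → ∀ k →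
               dlog ((w * y) * inv (z * t)) k ≈ (dlog w k + dlog y k) + - (dlog z k + dlog t k)
  dlog-ratio {w} {y} {z} {t} w≉0 y≉0 z≉0 t≉0 k = begin
    dlog ((w * y) * inv (z * t)) k               ≈⟨ dlog-* (*-≉0 w≉0 y≉0) (inv-≉0 (*-≉0 z≉0 t≉0)) k ⟩
    dlog (w * y) k + dlog (inv (z * t)) k        ≈⟨ +-congˡ (dlog-inv (*-≉0 z≉0 t≉0) k) ⟩
    dlog (w * y) k + - dlog (z * t) k            ≈⟨ +-cong (dlog-* w≉0 y≉0 k) (-‿cong (dlog-* z≉0 t≉0 k)) ⟩
    (dlog w k + dlog y k) + - (dlog z k + dlog t k) ∎

  -- The standard coordinates x₀, …, x₃

  module Coordinates (x : Fin 4 → Carrier) (∂x≈δ : ∀ k l → ∂ k (x l) ≈ δ k l) (x≉0 : ∀ p → x p ≉ 0#) where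

    dlogx : Fin 4 → Fin 4 → Carrier
    dlogx k p = dlog (x p) k

    dlogx≈δ : ∀ k p → dlogx k p ≈ inv (x p) * δ k p
    dlogx≈δ k p = *-congˡ (∂x≈δ k p)

    ∂∂x-comm : ∀ p i j → ∂ i (∂ j (x p)) ≈ ∂ j (∂ i (x p))
    ∂∂x-comm p i j = begin
      ∂ i (∂ j (x p))  ≈⟨ ∂-cong i (∂x≈δ j p) ⟩
      ∂ i (δ j p)      ≈⟨ ∂-δ j p i ⟩
      0#               ≈⟨ ∂-δ i p j ⟨
      ∂ j (δ i p)      ≈⟨ ∂-cong j (∂x≈δ i p) ⟨
      ∂ j (∂ i (x p))  ∎

    closed : ∀ c → Closed (ωc c x)
    closed c = ωc-closed c x≉0 (λ p → dlog-closed (x≉0 p) (∂∂x-comm p))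

    ωc-at-x : ∀ c i k → ωc c x i k ≈ inv (x i) * (A (ι c) i k * inv (x k))
    ωc-at-x c i k = begin
      ωc c x i k                                                            ≈⟨ ωc≈logForm c x≉0 i k ⟩
      logForm (ι c) (dlogx i) (dlogx k)                                     ≈⟨ logForm-cong (ι c) (dlogx≈δ i) (dlogx≈δ k) ⟩
      logForm (ι c) (λ p → inv (x p) * δ i p) (λ q → inv (x q) * δ k q)    ≈⟨ logForm-δ (ι c) (inv ∘ x) i k ⟩
      inv (x i) * (A (ι c) i k * inv (x k))                                 ∎

    nondegenerate : ∀ c → c ≢ 2 → Nondegenerate (ωc c x)
    nondegenerate c c≢2 = congruent-nondegenerate {ωc c x} (inv ∘ x) (A (ι c)) M (inv-≉0 ∘ x≉0) (ωc-at-x c) A·M≈I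
      where
      M : Fin 4 → Fin 4 → Carrier
      M k j = inv (pf (ι c)) * adj (ι c) k j

      A·M≈I : ∀ i j → Σ (λ k → A (ι c) i k * M k j) ≈ δ i j
      A·M≈I i j = begin
        Σ (λ k → A (ι c) i k * (inv (pf (ι c)) * adj (ι c) k j))
          ≈⟨ sum-cong-≋ {4} (λ k → x∙yz≈y∙xz (A (ι c) i k) (inv (pf (ι c))) (adj (ι c) k j)) ⟩
        Σ (λ k → inv (pf (ι c)) * (A (ι c) i k * adj (ι c) k j))
          ≈⟨ *-distribˡ-sum (inv (pf (ι c))) (λ k → A (ι c) i k * adj (ι c) k j) ⟨
        inv (pf (ι c)) * A·adj (ι c) i j
          ≈⟨ *-congˡ (A·adj≈pf·δ (ι c) i j) ⟩
        inv (pf (ι c)) * (pf (ι c) * δ i j)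
          ≈⟨ *-assoc _ _ _ ⟨
        (inv (pf (ι c)) * pf (ι c)) * δ i j
          ≈⟨ trans (*-congʳ (inverseˡ (pf≉0 c c≢2))) (*-identityˡ _) ⟩
        δ i j
          ∎

    u₁≉0 : u₁ x ≉ 0#
    u₁≉0 = *-≉0 (*-≉0 (x≉0 0F) (x≉0 2F)) (inv-≉0 (*-≉0 (x≉0 1F) (x≉0 1F)))

    u₂≉0 : u₂ x ≉ 0#
    u₂≉0 = *-≉0 (*-≉0 (x≉0 1F) (x≉0 3F)) (inv-≉0 (*-≉0 (x≉0 2F) (x≉0 2F)))

    ω≈ω₁* : ωc 2 x ≈₂ ω₁* x
    ω≈ω₁* i j = begin
      ωc 2 x i j
        ≈⟨ ωc≈logForm 2 x≉0 i j ⟩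
      logForm (ι 2) (dlogx i) (dlogx j)
        ≈⟨ logForm-ι2 (dlogx i) (dlogx j) ⟩
      logu₁ (dlogx i) * logu₂ (dlogx j) - logu₁ (dlogx j) * logu₂ (dlogx i)
        ≈⟨ +-cong (*-cong (dlog-u₁ i) (dlog-u₂ j)) (-‿cong (*-cong (dlog-u₁ j) (dlog-u₂ i))) ⟨
      (dlog (u₁ x) ∧ dlog (u₂ x)) i j
        ≈⟨ log-wedge u₁≉0 u₂≉0 i j ⟨
      ω₁* x i j
        ∎
      where
      dlog-u₁ : ∀ k → dlog (u₁ x) k ≈ logu₁ (dlogx k)
      dlog-u₁ = dlog-ratio (x≉0 0F) (x≉0 2F) (x≉0 1F) (x≉0 1F)
      dlog-u₂ : ∀ k → dlog (u₂ x) k ≈ logu₂ (dlogx k)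
      dlog-u₂ = dlog-ratio (x≉0 1F) (x≉0 3F) (x≉0 2F) (x≉0 2F)

    euler : ∀ p → contract x (dlog (x p)) ≈ 1#
    euler p = begin
      Σ (λ k → x k * (inv (x p) * ∂ k (x p)))
        ≈⟨ sum-cong-≋ {4} (λ k → trans (*-congˡ {x k} (dlogx≈δ k p)) (sym (*-assoc (x k) (inv (x p)) (δ k p)))) ⟩
      Σ (λ k → (x k * inv (x p)) * δ k p)
        ≈⟨ sum-δˡ (λ k → x k * inv (x p)) p ⟩
      x p * inv (x p)
        ≈⟨ inverseʳ (x p) (x≉0 p) ⟩
      1#
        ∎

    euler-ratio : ∀ p q r t → contract x (dlog ((x p * x q) * inv (x r * x t))) ≈ 0#
    euler-ratio p q r t = begin
      contract x (dlog ((x p * x q) * inv (x r * x t)))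
        ≈⟨ sum-cong-≋ {4} (λ k → *-congˡ {x k} (dlog-ratio (x≉0 p) (x≉0 q) (x≉0 r) (x≉0 t) k)) ⟩
      contract x (λ k → (dlogx k p + dlogx k q) + - (dlogx k r + dlogx k t))
        ≈⟨ contract-+ x (λ k → dlogx k p + dlogx k q) (λ k → - (dlogx k r + dlogx k t)) ⟩
      contract x (λ k → dlogx k p + dlogx k q) + contract x (λ k → - (dlogx k r + dlogx k t))
        ≈⟨ +-cong (contract-+ x (dlog (x p)) (dlog (x q)))
                  (trans (contract-‿ x (λ k → dlogx k r + dlogx k t)) (-‿cong (contract-+ x (dlog (x r)) (dlog (x t))))) ⟩
      (contract x (dlog (x p)) + contract x (dlog (x q))) + - (contract x (dlog (x r)) + contract x (dlog (x t)))
        ≈⟨ +-cong (+-cong (euler p) (euler q)) (-‿cong (+-cong (euler r) (euler t))) ⟩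
      (1# + 1#) + - (1# + 1#)
        ≈⟨ -‿inverseʳ (1# + 1#) ⟩
      0#
        ∎

    degenerate : ¬ Nondegenerate (ωc 2 x)
    degenerate = kernel⇒degenerate {ωc 2 x} x 0F (x≉0 0F) x-in-kernel
      where
      x-in-kernel : ∀ k → Σ (λ j → x j * ωc 2 x j k) ≈ 0#
      x-in-kernel k = begin
        Σ (λ j → x j * ωc 2 x j k)
          ≈⟨ sum-cong-≋ {4} (λ j → *-congˡ {x j} (trans (ω≈ω₁* j k) (log-wedge u₁≉0 u₂≉0 j k))) ⟩
        Σ (λ j → x j * (dlog (u₁ x) ∧ dlog (u₂ x)) j k)
          ≈⟨ ∧-kernel x (dlog (u₁ x)) (dlog (u₂ x)) (euler-ratio 0F 2F 1F 1F) (euler-ratio 1F 3F 2F 2F) k ⟩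
        0#
          ∎

    module Pullback (β : Carrier) (β-constant : Constant β) (c : ℕ) where

      numerator : Carrier
      numerator = x 1F * x 3F + β * pow (x 2F) c

      ∂-numerator : ∀ k → ∂ k numerator ≈
        (x 1F * x 3F) * (dlogx k 1F + dlogx k 3F) + (β * pow (x 2F) c) * (ι c * dlogx k 2F)
      ∂-numerator k = begin
        ∂ k (x 1F * x 3F + β * pow (x 2F) c)
          ≈⟨ ∂-+ k _ _ ⟩
        ∂ k (x 1F * x 3F) + ∂ k (β * pow (x 2F) c)
          ≈⟨ +-cong (∂≈*dlog x₁x₃≉0 k) (∂-constant-* β-constant k _) ⟩
        (x 1F * x 3F) * dlog (x 1F * x 3F) k + β * ∂ k (pow (x 2F) c)
          ≈⟨ +-cong (*-congˡ (dlog-* (x≉0 1F) (x≉0 3F) k)) (*-congˡ (∂≈*dlog (pow-≉0 c (x≉0 2F)) k)) ⟩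
        (x 1F * x 3F) * (dlogx k 1F + dlogx k 3F) + β * (pow (x 2F) c * dlog (pow (x 2F) c) k)
          ≈⟨ +-congˡ (trans (*-congˡ (*-congˡ (dlog-pow c (x≉0 2F) k))) (sym (*-assoc _ _ _))) ⟩
        (x 1F * x 3F) * (dlogx k 1F + dlogx k 3F) + (β * pow (x 2F) c) * (ι c * dlogx k 2F)
          ∎
        where
        x₁x₃≉0 : x 1F * x 3F ≉ 0#
        x₁x₃≉0 = *-≉0 (x≉0 1F) (x≉0 3F)

      numerator≉0 : numerator ≉ 0#
      numerator≉0 = ≉0-from-∂ 1F (≉0-resp-≈ (sym ∂₁≈x₃) (x≉0 3F))
        where
        ∂₁≈x₃ : ∂ 1F numerator ≈ x 3F
        ∂₁≈x₃ = begin
          ∂ 1F numerator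
            ≈⟨ ∂-numerator 1F ⟩
          (x 1F * x 3F) * (dlogx 1F 1F + dlogx 1F 3F) + (β * pow (x 2F) c) * (ι c * dlogx 1F 2F)
            ≈⟨ +-cong (*-congˡ (+-cong (dlogx≈δ 1F 1F) (dlogx≈δ 1F 3F))) (*-congˡ (*-congˡ (dlogx≈δ 1F 2F))) ⟩
          (x 1F * x 3F) * (inv (x 1F) * 1# + inv (x 3F) * 0#) + (β * pow (x 2F) c) * (ι c * (inv (x 2F) * 0#))
            ≈⟨ solve 7 (λ x₁ x₃ y₁ y₂ y₃ b C →
                 (x₁ :* x₃) :* (y₁ :* con (+ 1) :+ y₃ :* con (+ 0)) :+ b :* (C :* (y₂ :* con (+ 0)))
                 := (x₁ :* y₁) :* x₃)
               refl (x 1F) (x 3F) (inv (x 1F)) (inv (x 2F)) (inv (x 3F)) (β * pow (x 2F) c) (ι c) ⟩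
          (x 1F * inv (x 1F)) * x 3F
            ≈⟨ trans (*-congʳ (inverseʳ (x 1F) (x≉0 1F))) (*-identityˡ _) ⟩
          x 3F
            ∎

      s : Carrier
      s = (x 1F * x 3F) * inv numerator

      dlog-numerator : ∀ k → dlog numerator k ≈ s * (dlogx k 1F + dlogx k 3F) + (1# - s) * ι c * dlogx k 2F
      dlog-numerator k = begin
        inv numerator * ∂ k numerator
          ≈⟨ *-congˡ (∂-numerator k) ⟩
        inv numerator * ((x 1F * x 3F) * (dlogx k 1F + dlogx k 3F) + (β * pow (x 2F) c) * (ι c * dlogx k 2F))
          ≈⟨ solve 7 (λ y a b C u₁ u₂ u₃ → y :* (a :* (u₁ :+ u₃) :+ b :* (C :* u₂)) := (a :* y) :* (u₁ :+ u₃) :+ (b :* y) :* C :* u₂)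
               refl (inv numerator) (x 1F * x 3F) (β * pow (x 2F) c) (ι c) (dlogx k 1F) (dlogx k 2F) (dlogx k 3F) ⟩
        s * (dlogx k 1F + dlogx k 3F) + ((β * pow (x 2F) c) * inv numerator) * ι c * dlogx k 2F
          ≈⟨ +-congˡ (*-congʳ (*-congʳ complement)) ⟩
        s * (dlogx k 1F + dlogx k 3F) + (1# - s) * ι c * dlogx k 2F
          ∎
        where
        complement : (β * pow (x 2F) c) * inv numerator ≈ 1# - s
        complement = begin
          (β * pow (x 2F) c) * inv numerator
            ≈⟨ solve 3 (λ a b y → b :* y := (a :+ b) :* y :- a :* y)
                 refl (x 1F * x 3F) (β * pow (x 2F) c) (inv numerator) ⟩
          numerator * inv numerator - s
            ≈⟨ +-congʳ (inverseʳ numerator numerator≉0) ⟩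
          1# - s
            ∎

      dlog-φ : ∀ k p → dlog (φ c β x p) k ≈ shift (ι c) s (dlogx k) p
      dlog-φ k 0F = refl
      dlog-φ k 1F = refl
      dlog-φ k 2F = refl
      dlog-φ k 3F = trans (dlog-* numerator≉0 (inv-≉0 (x≉0 0F)) k)
                          (+-cong (dlog-numerator k) (dlog-inv (x≉0 0F) k))

      φ≉0 : ∀ p → φ c β x p ≉ 0#
      φ≉0 0F = x≉0 1F
      φ≉0 1F = x≉0 2F
      φ≉0 2F = x≉0 3F
      φ≉0 3F = *-≉0 numerator≉0 (inv-≉0 (x≉0 0F))

      invariant : ωc c (φ c β x) ≈₂ ωc c x
      invariant i j = begin
        ωc c (φ c β x) i j
          ≈⟨ ωc≈logForm c φ≉0 i j ⟩
        logForm (ι c) (λ p → dlog (φ c β x p) i) (λ q → dlog (φ c β x q) j)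
          ≈⟨ logForm-cong (ι c) (dlog-φ i) (dlog-φ j) ⟩
        logForm (ι c) (shift (ι c) s (dlogx i)) (shift (ι c) s (dlogx j))
          ≈⟨ logForm-shift (ι c) s (dlogx i) (dlogx j) ⟩
        logForm (ι c) (dlogx i) (dlogx j)
          ≈⟨ ωc≈logForm c x≉0 i j ⟨
        ωc c x i j
          ∎

corollary3p3 : ∀ {a ℓ : Level} (K : DiffField a ℓ) →
    let open DiffField K
        open Forms K
    in (x : Fin 4 → Carrier) →
       (∀ k l → ∂ k (x l) ≈ δ k l) →
       (∀ i → x i ≉ 0#) →
       (β : Carrier) → (∀ k → ∂ k β ≈ 0#) →
       (c : ℕ) →
       (ωc c (φ c β x) ≈₂ ωc c x)
       × (c ≢ 2 → Symplectic (ωc c x))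
       × (c ≡ 2 → ¬ Nondegenerate (ωc c x) × (ωc c x ≈₂ ω₁* x))
corollary3p3 K x ∂x≈δ x≉0 β β-constant c =
  invariant , (λ c≢2 → closed c , nondegenerate c c≢2) , λ { ≡.refl → degenerate , ω≈ω₁* }
  where
  open Coordinates K x ∂x≈δ x≉0
  open Pullback β β-constant c
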